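{- Let $w$ and $v$ be subwords of the paperfolding word $\mathbf{f}$ with $|w| = |v| \geq 8$. If the word obtained from $w$ by removing the first occurrence of $1$ in $w$ and appending it at the end equals the word obtained from $v$ by removing the first occurrence of $1$ in $v$ and appending it at the end, then $v = w$.
   Context: "Subword" means factor (contiguous block). The paperfolding word is $\mathbf{f} = f_1 f_2 f_3 \cdots$ where, for a positive integer $n = n' 2^{k}$ with $n'$ odd, $f_n = 0$ if $n' \equiv 1 \pmod 4$ and $f_n = 1$ if $n' \equiv 3 \pmod 4$; thus $\mathbf{f} = 001001100011011000100111\cdots$. (Every subword of $\mathbf{f}$ of length at least $8$ contains both a $0$ and a $1$.) -}

module Defs where

open import Data.Nat using (ℕ; zero; suc; _+_; _%_; _/_; _≡ᵇ_)
open import Data.Bool using (Bool; true; false; if_then_else_)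
open import Data.List using (List; []; _∷_; _++_; map; upTo)
open import Data.Product using (∃-syntax; _×_)
open import Relation.Binary.PropositionalEquality using (_≡_)

-- Letters: 0 is represented by false, 1 by true.

-- Auxiliary: paperfolding letter of n with fuel (fuel ≥ n suffices).
-- For n = n' 2^k with n' odd: letter is 0 iff n' ≡ 1 (mod 4).
pfAux : ℕ → ℕ → Bool
pfAux zero    n = false
pfAux (suc k) n with n % 2 ≡ᵇ 0
... | true  = pfAux k (n / 2)
... | false = n % 4 ≡ᵇ 3

-- f n  (meaningful for n ≥ 1; the word is f 1, f 2, f 3, …)
paperfold : ℕ → Bool
paperfold n = pfAux n n

-- The factor of length m of f starting at position i+1: f_{i+1} … f_{i+m}
factorAt : ℕ → ℕ → List Bool
factorAt i m = map (λ j → paperfold (suc (i + j))) (upTo m)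

IsSubword : List Bool → Set
IsSubword w = ∃[ i ] w ≡ factorAt i (Data.List.length w)

removeFirst1 : List Bool → List Bool
removeFirst1 []          = []
removeFirst1 (true ∷ xs) = xs
removeFirst1 (false ∷ xs) = false ∷ removeFirst1 xs

hasOne : List Bool → Bool
hasOne []          = false
hasOne (true ∷ _)  = true
hasOne (false ∷ xs) = hasOne xs

moveFirst1 : List Bool → List Bool
moveFirst1 w = if hasOne w then removeFirst1 w ++ (true ∷ []) else w

-- Since f₂ₙ = fₙ, f₄ₙ₊₁ = 0 and f₄ₙ₊₃ = 1, the paperfolding word agrees with the
-- 16-periodic word (0010011·0011011·)^ω at every position that is not a multiple of 8.
-- Hence a factor of length 8 is determined by its starting position modulo 16 and by
-- its single letter at a multiple of 8: there are at most 32 such factors, and a finite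
-- check shows that each contains a 1 and that deleting the first 1 is injective on them.
-- For factors w = P X and v = P′ Y with |P| = |P′| = 8, the first 1 lies in the prefix,
-- so moving it to the end gives removeFirst1 P · X · 1; equal results force X = Y and
-- removeFirst1 P = removeFirst1 P′, hence P = P′.
module Submission where

open import Data.Bool using (Bool; true; false)
open import Data.Bool.Properties using () renaming (_≟_ to _≟ᴮ_)
open import Data.List
  using (List; []; _∷_; _++_; _∷ʳ_; length; map; upTo; applyUpTo; take; drop; cartesianProductWith)
open import Data.List.Membership.Propositional using (_∈_)
open import Data.List.Membership.Propositional.Properties using (∈-upTo⁺; ∈-cartesianProductWith⁺)
open import Data.List.Properties
  using (∷-injective; ∷ʳ-injectiveˡ; map-cong; map-upTo; take++drop≡id; length-take; ≡-dec)
open import Data.List.Relation.Unary.All as All using (All; []; _∷_; all?)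
open import Data.List.Relation.Unary.Any using (here; there)
open import Data.Nat using (ℕ; zero; suc; NonZero; _+_; _*_; _∸_; _%_; _/_; _≡ᵇ_; _≤_; s≤s; z≤n)
open import Data.Nat.DivMod
  using (m≡m%n+[m/n]*n; m%n%n≡m%n; m%n<n; m*n%n≡0; m*n/n≡m; m/n<m; /-monoˡ-≤; %-distribˡ-+; %-remove-+ʳ)
open import Data.Nat.Divisibility using (_∣_; divides; ∣-trans; n∣m*n; ∣n⇒∣m*n)
open import Data.Nat.Properties
  using (≤-refl; ≤-pred; ≤-<-trans; m≤m*n; m≤n⇒m⊓n≡m; suc-injective; +-suc; *-assoc; *-distribʳ-+)
open import Data.Product using (_×_; _,_; proj₁; proj₂; ∃-syntax; map₁)
open import Function using (_∘_)
open import Relation.Binary.PropositionalEquality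
  using (_≡_; refl; sym; trans; cong; cong₂; subst; subst₂; module ≡-Reasoning)
open import Relation.Nullary.Decidable using (from-yes; _→-dec_)

open import Defs

++-cancel-≡length : ∀ {A : Set} (xs ys : List A) {zs ws} → length xs ≡ length ys →
                    xs ++ zs ≡ ys ++ ws → xs ≡ ys × zs ≡ ws
++-cancel-≡length []       []       _   eq = refl , eq
++-cancel-≡length (x ∷ xs) (y ∷ ys) len eq with refl , eq′ ← ∷-injective eq =
  map₁ (cong (x ∷_)) (++-cancel-≡length xs ys (suc-injective len) eq′)

take-applyUpTo : ∀ {A : Set} (f : ℕ → A) {m n} → m ≤ n → take m (applyUpTo f n) ≡ applyUpTo f m
take-applyUpTo f z≤n       = refl
take-applyUpTo f (s≤s m≤n) = cong (f 0 ∷_) (take-applyUpTo (f ∘ suc) m≤n)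

length-take-≤ : ∀ {A : Set} {m} (xs : List A) → m ≤ length xs → length (take m xs) ≡ m
length-take-≤ {m = m} xs m≤ = trans (length-take m xs) (m≤n⇒m⊓n≡m m≤)

[m%d+n]%d≡[m+n]%d : ∀ m n d .{{_ : NonZero d}} → (m % d + n) % d ≡ (m + n) % d
[m%d+n]%d≡[m+n]%d m n d = begin
  (m % d + n) % d           ≡⟨ %-distribˡ-+ (m % d) n d ⟩
  (m % d % d + n % d) % d   ≡⟨ cong (λ x → (x + n % d) % d) (m%n%n≡m%n m d) ⟩
  (m % d + n % d) % d       ≡⟨ %-distribˡ-+ m n d ⟨
  (m + n) % d               ∎
  where open ≡-Reasoning

hasOne-++ : ∀ P X → hasOne P ≡ true → hasOne (P ++ X) ≡ true
hasOne-++ (true  ∷ P) X _ = refl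
hasOne-++ (false ∷ P) X h = hasOne-++ P X h

removeFirst1-++ : ∀ P X → hasOne P ≡ true → removeFirst1 (P ++ X) ≡ removeFirst1 P ++ X
removeFirst1-++ (true  ∷ P) X _ = refl
removeFirst1-++ (false ∷ P) X h = cong (false ∷_) (removeFirst1-++ P X h)

length-removeFirst1 : ∀ P → hasOne P ≡ true → suc (length (removeFirst1 P)) ≡ length P
length-removeFirst1 (true  ∷ P) _ = refl
length-removeFirst1 (false ∷ P) h = cong suc (length-removeFirst1 P h)

moveFirst1-++ : ∀ P X → hasOne P ≡ true → moveFirst1 (P ++ X) ≡ (removeFirst1 P ++ X) ∷ʳ true
moveFirst1-++ P X h rewrite hasOne-++ P X h = cong (_∷ʳ true) (removeFirst1-++ P X h)

moveFirst1-++-injective : ∀ {P P′ X Y} → hasOne P ≡ true → hasOne P′ ≡ true → length P ≡ length P′ →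
  (removeFirst1 P ≡ removeFirst1 P′ → P ≡ P′) →
  moveFirst1 (P ++ X) ≡ moveFirst1 (P′ ++ Y) → P ++ X ≡ P′ ++ Y
moveFirst1-++-injective {P} {P′} {X} {Y} h h′ len removeFirst1-inj moved≡ =
  cong₂ _++_ (removeFirst1-inj (proj₁ cancelled)) (proj₂ cancelled)
  where
  removed-length≡ : length (removeFirst1 P) ≡ length (removeFirst1 P′)
  removed-length≡ =
    suc-injective (trans (length-removeFirst1 P h) (trans len (sym (length-removeFirst1 P′ h′))))
  appended≡ : (removeFirst1 P ++ X) ∷ʳ true ≡ (removeFirst1 P′ ++ Y) ∷ʳ true
  appended≡ = trans (sym (moveFirst1-++ P X h)) (trans moved≡ (moveFirst1-++ P′ Y h′))
  cancelled : removeFirst1 P ≡ removeFirst1 P′ × X ≡ Y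
  cancelled = ++-cancel-≡length (removeFirst1 P) (removeFirst1 P′) removed-length≡
                                (∷ʳ-injectiveˡ _ _ appended≡)

pfAux-even : ∀ k n → pfAux (suc k) (n * 2) ≡ pfAux k n
pfAux-even k n with n * 2 % 2 | m*n%n≡0 n 2
... | .0 | refl = cong (pfAux k) (m*n/n≡m n 2)

pfAux-odd : ∀ k n → n % 2 ≡ 1 → pfAux (suc k) n ≡ (n % 4 ≡ᵇ 3)
pfAux-odd k n n-odd with n % 2 | n-odd
... | .1 | refl = refl

pfAux-fuel : ∀ k k′ n → n ≤ k → n ≤ k′ → pfAux k n ≡ pfAux k′ n
pfAux-fuel zero    zero     _ _   _    = refl
pfAux-fuel zero    (suc k′) 0 z≤n _    = pfAux-fuel zero k′ 0 z≤n z≤n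
pfAux-fuel (suc k) zero     0 _   z≤n  = pfAux-fuel k zero 0 z≤n z≤n
pfAux-fuel (suc k) (suc k′) n n≤k n≤k′ with n % 2 ≡ᵇ 0
... | true  = pfAux-fuel k k′ (n / 2) (n≤1+k⇒n/2≤k n≤k) (n≤1+k⇒n/2≤k n≤k′)
  where
  n≤1+k⇒n/2≤k : ∀ {k} → n ≤ suc k → n / 2 ≤ k
  n≤1+k⇒n/2≤k {k} n≤ = ≤-pred (≤-<-trans (/-monoˡ-≤ 2 n≤) (m/n<m (suc k) 2 ≤-refl))
... | false = refl

paperfold-double : ∀ n → paperfold (n * 2) ≡ paperfold n
paperfold-double zero    = refl
paperfold-double (suc n) = trans (pfAux-even (suc (n * 2)) (suc n))
  (pfAux-fuel (suc (n * 2)) (suc n) (suc n) (s≤s (m≤m*n n 2)) ≤-refl)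

paperfold-odd : ∀ n → n % 2 ≡ 1 → paperfold n ≡ (n % 4 ≡ᵇ 3)
paperfold-odd zero    ()
paperfold-odd (suc n) = pfAux-odd n (suc n)

-- The letter of f at a position with residue t modulo 16.  At the residues 0 and 8
-- it is not determined by t and is supplied as b (as it is, as junk, for t ≥ 16).
template : Bool → ℕ → Bool
template _ 1  = false
template _ 2  = false
template _ 3  = true
template _ 4  = false
template _ 5  = false
template _ 6  = true
template _ 7  = true
template _ 9  = false
template _ 10 = false
template _ 11 = true
template _ 12 = true
template _ 13 = false
template _ 14 = true
template _ 15 = true
template b _  = b

paperfold-residues : ∀ q →
  All (λ t → paperfold (t + q * 16) ≡ template (paperfold (t + q * 16)) t) (upTo 16)
paperfold-residues q =
    refl
  ∷ odd 1 4 refl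
  ∷ trans (even 1 8) (odd 1 2 refl)
  ∷ odd 3 4 refl
  ∷ trans (even 2 8) (trans (even 1 4) (odd 1 1 refl))
  ∷ odd 5 4 refl
  ∷ trans (even 3 8) (odd 3 2 refl)
  ∷ odd 7 4 refl
  ∷ refl
  ∷ odd 9 4 refl
  ∷ trans (even 5 8) (odd 5 2 refl)
  ∷ odd 11 4 refl
  ∷ trans (even 6 8) (trans (even 3 4) (odd 3 1 refl))
  ∷ odd 13 4 refl
  ∷ trans (even 7 8) (odd 7 2 refl)
  ∷ odd 15 4 refl
  ∷ []
  where
  even : ∀ s c → paperfold (s * 2 + q * (c * 2)) ≡ paperfold (s + q * c)
  even s c = trans (cong paperfold halved) (paperfold-double (s + q * c))
    where
    halved : s * 2 + q * (c * 2) ≡ (s + q * c) * 2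
    halved = trans (cong (s * 2 +_) (sym (*-assoc q c 2))) (sym (*-distribʳ-+ 2 s (q * c)))
  odd : ∀ t c → t % 2 ≡ 1 → paperfold (t + q * (c * 4)) ≡ (t % 4 ≡ᵇ 3)
  odd t c t-odd = trans (paperfold-odd (t + q * (c * 4)) (trans (%-remove-+ʳ t 2∣) t-odd))
                        (cong (_≡ᵇ 3) (%-remove-+ʳ t 4∣))
    where
    4∣ : 4 ∣ q * (c * 4)
    4∣ = ∣n⇒∣m*n q (n∣m*n c)
    2∣ : 2 ∣ q * (c * 4)
    2∣ = ∣-trans (divides 2 refl) 4∣

paperfold≡template : ∀ m → paperfold m ≡ template (paperfold m) (m % 16)
paperfold≡template m =
  subst (λ n → paperfold n ≡ template (paperfold n) (m % 16)) (sym (m≡m%n+[m/n]*n m 16))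
        (All.lookup (paperfold-residues (m / 16)) (∈-upTo⁺ (m%n<n m 16)))

templateWord : ℕ → Bool → List Bool
templateWord r b = map (λ j → template b ((r + suc j) % 16)) (upTo 8)

factorAt≡map-template : ∀ i →
  factorAt i 8 ≡ map (λ j → template (paperfold (suc (i + j))) ((i % 16 + suc j) % 16)) (upTo 8)
factorAt≡map-template i = map-cong letter (upTo 8)
  where
  letter : ∀ j → paperfold (suc (i + j)) ≡ template (paperfold (suc (i + j))) ((i % 16 + suc j) % 16)
  letter j = trans (paperfold≡template (suc (i + j)))
    (cong (template _) (trans (cong (_% 16) (sym (+-suc i j))) (sym ([m%d+n]%d≡[m+n]%d i (suc j) 16))))

-- Among the positions r + 1, …, r + 8 only r + 1 + (7 ∸ r % 8) is a multiple of 8.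
map-template≡templateWord : ∀ (g : ℕ → Bool) →
  All (λ r → map (λ j → template (g j) ((r + suc j) % 16)) (upTo 8) ≡ templateWord r (g (7 ∸ r % 8)))
      (upTo 16)
map-template≡templateWord g =
  refl ∷ refl ∷ refl ∷ refl ∷ refl ∷ refl ∷ refl ∷ refl ∷ refl ∷ refl ∷ refl ∷ refl ∷ refl ∷ refl ∷ refl ∷ refl ∷ []

factorAt≡templateWord : ∀ i → ∃[ b ] factorAt i 8 ≡ templateWord (i % 16) b
factorAt≡templateWord i = letter (7 ∸ i % 16 % 8) , trans (factorAt≡map-template i)
  (All.lookup (map-template≡templateWord letter) (∈-upTo⁺ (m%n<n i 16)))
  where
  letter : ℕ → Bool
  letter j = paperfold (suc (i + j))

templateWords : List (List Bool)
templateWords = cartesianProductWith templateWord (upTo 16) (false ∷ true ∷ [])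

subword-length8∈templateWords : ∀ {P} → IsSubword P → length P ≡ 8 → P ∈ templateWords
subword-length8∈templateWords (i , P≡) |P|≡8 =
  subst (_∈ templateWords) (sym (trans P≡ (trans (cong (factorAt i) |P|≡8) (proj₂ (factorAt≡templateWord i)))))
    (∈-cartesianProductWith⁺ templateWord (∈-upTo⁺ (m%n<n i 16)) (bool∈ _))
  where
  bool∈ : ∀ b → b ∈ false ∷ true ∷ []
  bool∈ false = here refl
  bool∈ true  = there (here refl)

templateWords-hasOne : All (λ P → hasOne P ≡ true) templateWords
templateWords-hasOne = from-yes (all? (λ P → hasOne P ≟ᴮ true) templateWords)

removeFirst1-injectiveOn-templateWords :
  All (λ P → All (λ P′ → removeFirst1 P ≡ removeFirst1 P′ → P ≡ P′) templateWords) templateWords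
removeFirst1-injectiveOn-templateWords = from-yes (all? (λ P → all? (λ P′ →
  ≡-dec _≟ᴮ_ (removeFirst1 P) (removeFirst1 P′) →-dec ≡-dec _≟ᴮ_ P P′) templateWords) templateWords)

take-factorAt : ∀ i {m n} → m ≤ n → take m (factorAt i n) ≡ factorAt i m
take-factorAt i {m} {n} m≤n = begin
  take m (map letter (upTo n))  ≡⟨ cong (take m) (map-upTo letter n) ⟩
  take m (applyUpTo letter n)   ≡⟨ take-applyUpTo letter m≤n ⟩
  applyUpTo letter m            ≡⟨ map-upTo letter m ⟨
  map letter (upTo m)           ∎
  where
  open ≡-Reasoning
  letter : ℕ → Bool
  letter j = paperfold (suc (i + j))

IsSubword-take : ∀ {m w} → IsSubword w → m ≤ length w → IsSubword (take m w)
IsSubword-take {m} {w} (i , w≡) m≤ = i , (begin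
  take m w                         ≡⟨ cong (take m) w≡ ⟩
  take m (factorAt i (length w))   ≡⟨ take-factorAt i m≤ ⟩
  factorAt i m                     ≡⟨ cong (factorAt i) (length-take-≤ w m≤) ⟨
  factorAt i (length (take m w))   ∎)
  where open ≡-Reasoning

theorem2 : (w v : List Bool) → IsSubword w → IsSubword v →
    length w ≡ length v → 8 ≤ length w →
    moveFirst1 w ≡ moveFirst1 v → v ≡ w
theorem2 w v w-sub v-sub |w|≡|v| 8≤|w| moved≡ = sym (begin
  w                     ≡⟨ take++drop≡id 8 w ⟨
  take 8 w ++ drop 8 w  ≡⟨ moveFirst1-++-injective (hasOne∈ w-prefix) (hasOne∈ v-prefix) prefix-lengths≡
                             (All.lookup (All.lookup removeFirst1-injectiveOn-templateWords w-prefix) v-prefix)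
                             split-moved≡ ⟩
  take 8 v ++ drop 8 v  ≡⟨ take++drop≡id 8 v ⟩
  v                     ∎)
  where
  open ≡-Reasoning
  8≤|v| : 8 ≤ length v
  8≤|v| = subst (8 ≤_) |w|≡|v| 8≤|w|
  prefix∈ : ∀ {u} → IsSubword u → 8 ≤ length u → take 8 u ∈ templateWords
  prefix∈ {u} u-sub 8≤|u| = subword-length8∈templateWords (IsSubword-take u-sub 8≤|u|) (length-take-≤ u 8≤|u|)
  w-prefix : take 8 w ∈ templateWords
  w-prefix = prefix∈ w-sub 8≤|w|
  v-prefix : take 8 v ∈ templateWords
  v-prefix = prefix∈ v-sub 8≤|v|
  hasOne∈ : ∀ {P} → P ∈ templateWords → hasOne P ≡ true
  hasOne∈ = All.lookup templateWords-hasOne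
  prefix-lengths≡ : length (take 8 w) ≡ length (take 8 v)
  prefix-lengths≡ = trans (length-take-≤ w 8≤|w|) (sym (length-take-≤ v 8≤|v|))
  split-moved≡ : moveFirst1 (take 8 w ++ drop 8 w) ≡ moveFirst1 (take 8 v ++ drop 8 v)
  split-moved≡ = subst₂ (λ a b → moveFirst1 a ≡ moveFirst1 b)
                        (sym (take++drop≡id 8 w)) (sym (take++drop≡id 8 v)) moved≡
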